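{- Let $j \geq 3$. There is no finite binomial poset $P'$ of rank $j+1$ whose atom function satisfies $A'(n) = n$ for $n \leq j$ and $A'(j+1) = j+2$.
   Context: A finite binomial poset is a poset with a unique minimal element $\hat 0$ and a unique maximal element, in which every interval is graded (rank function $\rho$; $[x,y]$ is a $k$-interval if $\rho(y)-\rho(x)=k$), and for every $k$ up to the rank any two $k$-intervals have the same number $B(k)$ of maximal chains. The atom function is $A(k) = B(k)/B(k-1)$, the number of atoms of a $k$-interval. -}

module Defs where

open import Data.Nat using (ℕ; zero; suc; _∸_; _*_)
open import Data.Fin using (Fin; _≟_)
open import Data.Bool using (Bool; T; _∧_; not; if_then_else_)
open import Data.List using (map; allFin)
open import Data.Nat.ListAction using (sum)
open import Data.Bool.ListAction using (any)
open import Relation.Nullary.Decidable using (isYes)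
open import Relation.Binary.PropositionalEquality using (_≡_)

record FinitePoset : Set where
  field
    card    : ℕ
    le      : Fin card → Fin card → Bool
    le-refl    : ∀ x → T (le x x)
    le-antisym : ∀ x y → T (le x y) → T (le y x) → x ≡ y
    le-trans   : ∀ x y z → T (le x y) → T (le y z) → T (le x z)

  eqB : Fin card → Fin card → Bool
  eqB x y = isYes (x ≟ y)

  lt : Fin card → Fin card → Bool
  lt x y = le x y ∧ not (eqB x y)

  covers : Fin card → Fin card → Bool
  covers x y = lt x y ∧ not (any (λ z → lt x z ∧ lt z y) (allFin card))

  chainsFuel : ℕ → Fin card → Fin card → ℕ
  chainsFuel zero    x y = if eqB x y then 1 else 0
  chainsFuel (suc k) x y =
    if eqB x y then 1
    else sum (map (λ z → if covers x z ∧ le z y then chainsFuel k z y else 0) (allFin card))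

  -- number of maximal chains of the interval [x,y]
  -- (every saturated chain has length < card, so fuel card suffices)
  maxChains : Fin card → Fin card → ℕ
  maxChains x y = chainsFuel card x y

-- A finite binomial poset: a finite poset with 0̂ and 1̂, a rank function ρ
-- (so every interval [x,y] is graded of rank ρ y ∸ ρ x), and a function B
-- such that every k-interval has exactly B k maximal chains.
record FiniteBinomialPoset : Set where
  field
    poset : FinitePoset
  open FinitePoset poset public
  field
    bot     : Fin card
    top     : Fin card
    bot-min : ∀ x → T (le bot x)
    top-max : ∀ x → T (le x top)
    ρ       : Fin card → ℕ
    ρ-bot   : ρ bot ≡ 0
    ρ-cover : ∀ x y → T (covers x y) → ρ y ≡ suc (ρ x)
    B       : ℕ → ℕ
    B-spec  : ∀ x y → T (le x y) → maxChains x y ≡ B (ρ y ∸ ρ x)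

  rank : ℕ
  rank = ρ top

  -- "A(k) = a" where A(k) = B(k)/B(k-1) (B(k-1) ≥ 1 always), stated without division
  AtomFunctionIs : ℕ → ℕ → Set
  AtomFunctionIs k a = B k ≡ a * B (k ∸ 1)

module Submission where

-- Under the hypotheses every interval of rank m ≤ j has exactly m atoms, since A = B(m)/B(m-1)
-- counts atoms. So 2-intervals are diamonds, and no 3-interval contains two atoms with two common
-- covers. By induction on the rank, any two atoms of an interval of rank at most j have a common
-- cover. Now join two atoms of P′ when they have a common cover. Sending a cover x of an atom a to
-- the other atom below x is a bijection from the j covers of a onto its neighbours, and any two
-- neighbours of a are joined; so closed neighbourhoods are cliques of size j + 1 and the atoms split
-- into disjoint copies of K_{j+1}, which is impossible for j + 2 atoms.

open import Defs
open import Data.Nat using (ℕ; zero; suc; pred; _+_; _*_; _∸_; _≤_; _<_; z≤n; s≤s; _≤?_; ≢-nonZero)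
open import Data.Nat.Properties
open import Data.Nat.ListAction using (sum)
open import Data.Bool using (Bool; true; false; T; _∧_; not; if_then_else_)
open import Data.Bool.ListAction using (any)
open import Data.Bool.Properties using (T-∧; T-not-≡; T-≡)
open import Data.Fin using (Fin) renaming (_≟_ to _≟ᶠ_)
open import Data.Unit using (tt)
open import Data.Empty using (⊥; ⊥-elim)
open import Data.List using (List; []; _∷_; length; map; filter; allFin)
open import Data.List.Properties using (filter-notAll; map-cong; length-map)
open import Data.List.Relation.Unary.Any as Any using (here; there; any?)
open import Data.List.Relation.Unary.Any.Properties using (any⁻)
open import Data.List.Relation.Unary.All as All using (All; []; _∷_)
open import Data.List.Relation.Unary.AllPairs using ([]; _∷_)
open import Data.List.Relation.Unary.Unique.Propositional using (Unique)
import Data.List.Relation.Unary.Unique.Propositional.Properties as Unique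
open import Data.List.Membership.Propositional using (_∈_; _∉_; find; lose)
open import Data.List.Membership.Propositional.Properties using (∈-filter⁺; ∈-filter⁻; ∈-allFin; ∈-map⁺; ∈-map⁻)
open import Data.List.Relation.Unary.All.Properties using (¬Any⇒All¬)
open import Data.List.Relation.Binary.Subset.Propositional using (_⊆_)
open import Data.Product using (Σ; ∃-syntax; _×_; _,_; proj₁; proj₂)
open import Data.Sum using (_⊎_; inj₁; inj₂; [_,_]′)
open import Function using (_∘_; id; Equivalence)
open import Relation.Nullary using (¬_; yes; no; ¬?)
open import Relation.Nullary.Decidable using (_×-dec_; T?; isYes)
open import Relation.Binary.Definitions using (DecidableEquality)
open import Relation.Binary.PropositionalEquality
  using (_≡_; _≢_; refl; sym; trans; cong; cong₂; subst; module ≡-Reasoning)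

module DistinctLists {A : Set} (_≟_ : DecidableEquality A) where

  open import Data.List.Membership.DecPropositional _≟_ using (_∈?_)

  private
    variable
      a b c r : A
      xs ys : List A

  nonempty⇒∃∈ : 0 < length xs → ∃[ r ] r ∈ xs
  nonempty⇒∃∈ {r ∷ _} _ = r , here refl

  ⊆⇒length≤ : Unique xs → xs ⊆ ys → length xs ≤ length ys
  ⊆⇒length≤ {[]} _ _ = z≤n
  ⊆⇒length≤ {x ∷ xs} {ys} (x∉xs ∷ xs!) xs⊆ys =
    ≤-trans (s≤s (⊆⇒length≤ xs! xs⊆ys-x)) (filter-notAll (λ y → ¬? (y ≟ x)) ys x∈ys)
    where
    xs⊆ys-x : xs ⊆ filter (λ y → ¬? (y ≟ x)) ys
    xs⊆ys-x m = ∈-filter⁺ (λ y → ¬? (y ≟ x)) (xs⊆ys (there m)) (λ e → All.lookup x∉xs m (sym e))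
    x∈ys : Any.Any (λ y → ¬ ¬ y ≡ x) ys
    x∈ys = Any.map (λ e x≢y → x≢y (sym e)) (xs⊆ys (here refl))

  length<⇒∃∉ : Unique ys → length xs < length ys → ∃[ r ] r ∈ ys × r ∉ xs
  length<⇒∃∉ {ys} {xs} ys! xs<ys with any? (λ r → ¬? (r ∈? xs)) ys
  ... | yes found = find found
  ... | no none = ⊥-elim (<-irrefl refl (≤-trans xs<ys (⊆⇒length≤ ys! ys⊆xs)))
    where
    ys⊆xs : ys ⊆ xs
    ys⊆xs {r} r∈ys with r ∈? xs
    ... | yes r∈xs = r∈xs
    ... | no r∉xs = ⊥-elim (none (lose r∈ys r∉xs))

  length≤⇒⊇ : Unique xs → xs ⊆ ys → length ys ≤ length xs → ys ⊆ xs
  length≤⇒⊇ {xs} {ys} xs! xs⊆ys ys≤xs {r} r∈ys with r ∈? xs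
  ... | yes r∈xs = r∈xs
  ... | no r∉xs = ⊥-elim (<-irrefl refl (≤-trans (⊆⇒length≤ r∷xs! r∷xs⊆ys) ys≤xs))
    where
    r∷xs! : Unique (r ∷ xs)
    r∷xs! = ¬Any⇒All¬ xs r∉xs ∷ xs!
    r∷xs⊆ys : r ∷ xs ⊆ ys
    r∷xs⊆ys (here refl) = r∈ys
    r∷xs⊆ys (there z∈xs) = xs⊆ys z∈xs

  InjectiveOn : {B : Set} → (A → B) → List A → Set
  InjectiveOn f xs = ∀ {a b} → a ∈ xs → b ∈ xs → f a ≡ f b → a ≡ b

  map⁺ : ∀ {B : Set} {f : A → B} → InjectiveOn f xs → Unique xs → Unique (map f xs)
  map⁺ {[]} {f = f} _ [] = []
  map⁺ {x ∷ xs} {f = f} inj (x∉xs ∷ xs!) =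
    distinct xs x∉xs (λ m → m) ∷ map⁺ (λ a∈ b∈ → inj (there a∈) (there b∈)) xs!
    where
    distinct : ∀ zs → All (x ≢_) zs → zs ⊆ xs → All (f x ≢_) (map f zs)
    distinct [] _ _ = []
    distinct (z ∷ zs) (x≢z ∷ x∉zs) zs⊆xs =
      (λ e → x≢z (inj (here refl) (there (zs⊆xs (here refl))) e)) ∷ distinct zs x∉zs (λ m → zs⊆xs (there m))

  collision-or-injectiveOn : ∀ {B : Set} → DecidableEquality B → (f : A → B) → ∀ xs →
    (∃[ a ] ∃[ b ] a ∈ xs × b ∈ xs × a ≢ b × f a ≡ f b) ⊎ InjectiveOn f xs
  collision-or-injectiveOn _≟B_ f xs
    with any? (λ a → any? (λ b → ¬? (a ≟ b) ×-dec (f a ≟B f b)) xs) xs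
  ... | yes found with a , a∈ , found′ ← find found with b , b∈ , a≢b , fa≡fb ← find found′ =
    inj₁ (a , b , a∈ , b∈ , a≢b , fa≡fb)
  ... | no none = inj₂ injective
    where
    injective : InjectiveOn f xs
    injective {a} {b} a∈ b∈ fa≡fb with a ≟ b
    ... | yes a≡b = a≡b
    ... | no a≢b = ⊥-elim (none (lose a∈ (lose b∈ (a≢b , fa≡fb))))

  length≡2⇒pair : length ys ≡ 2 → a ∈ ys → b ∈ ys → a ≢ b → r ∈ ys → r ≡ a ⊎ r ≡ b
  length≡2⇒pair {ys} {a} {b} ys≡2 a∈ b∈ a≢b r∈
    with length≤⇒⊇ ((a≢b ∷ []) ∷ [] ∷ []) ab⊆ys (≤-reflexive ys≡2) r∈
    where
    ab⊆ys : a ∷ b ∷ [] ⊆ ys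
    ab⊆ys (here refl) = a∈
    ab⊆ys (there (here refl)) = b∈
  ... | here r≡a = inj₁ r≡a
  ... | there (here r≡b) = inj₂ r≡b

  length≡3⇒triple : length ys ≡ 3 → a ∈ ys → b ∈ ys → c ∈ ys → a ≢ b → a ≢ c → b ≢ c →
    r ∈ ys → r ≡ a ⊎ r ≡ b ⊎ r ≡ c
  length≡3⇒triple {ys = ys} {a = a} {b = b} {c = c} ys≡3 a∈ b∈ c∈ a≢b a≢c b≢c r∈
    with length≤⇒⊇ ((a≢b ∷ a≢c ∷ []) ∷ (b≢c ∷ []) ∷ [] ∷ []) abc⊆ys (≤-reflexive ys≡3) r∈
    where
    abc⊆ys : a ∷ b ∷ c ∷ [] ⊆ ys
    abc⊆ys (here refl) = a∈
    abc⊆ys (there (here refl)) = b∈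
    abc⊆ys (there (there (here refl))) = c∈
  ... | here r≡a = inj₁ r≡a
  ... | there (here r≡b) = inj₂ (inj₁ r≡b)
  ... | there (there (here r≡c)) = inj₂ (inj₂ r≡c)

  other : List A → A → A
  other [] a = a
  other (b ∷ ys) a with b ≟ a
  ... | yes _ = other ys a
  ... | no _ = b

  other-spec : r ∈ ys → r ≢ a → other ys a ∈ ys × other ys a ≢ a
  other-spec {ys = b ∷ ys} {a} (here refl) r≢a with b ≟ a
  ... | yes b≡a = ⊥-elim (r≢a b≡a)
  ... | no b≢a = here refl , b≢a
  other-spec {ys = b ∷ ys} {a} (there r∈) r≢a with b ≟ a
  ... | yes _ = let o∈ , o≢a = other-spec r∈ r≢a in there o∈ , o≢a
  ... | no b≢a = here refl , b≢a

module _ {A : Set} where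

  sum≢0⇒∃≢0 : ∀ (g : A → ℕ) xs → sum (map g xs) ≢ 0 → ∃[ z ] g z ≢ 0
  sum≢0⇒∃≢0 g [] sum≢0 = ⊥-elim (sum≢0 refl)
  sum≢0⇒∃≢0 g (x ∷ xs) sum≢0 with g x ≟ 0
  ... | no gx≢0 = x , gx≢0
  ... | yes gx≡0 = sum≢0⇒∃≢0 g xs (λ rest≡0 → sum≢0 (cong₂ _+_ gx≡0 rest≡0))

  sum-map-if-cong : ∀ (b : A → Bool) {f g : A → ℕ} → (∀ z → T (b z) → f z ≡ g z) → ∀ xs →
    sum (map (λ z → if b z then f z else 0) xs) ≡ sum (map (λ z → if b z then g z else 0) xs)
  sum-map-if-cong b {f} {g} f≡g = cong sum ∘ map-cong summand≡
    where
    summand≡ : ∀ z → (if b z then f z else 0) ≡ (if b z then g z else 0)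
    summand≡ z with b z | f≡g z
    ... | true | fz≡gz = fz≡gz tt
    ... | false | _ = refl

  sum-map-if-const : ∀ (b : A → Bool) n xs →
    sum (map (λ z → if b z then n else 0) xs) ≡ length (filter (λ z → T? (b z)) xs) * n
  sum-map-if-const b n [] = refl
  sum-map-if-const b n (x ∷ xs) with b x
  ... | true = cong (n +_) (sum-map-if-const b n xs)
  ... | false = sum-map-if-const b n xs

module Chains (P : FiniteBinomialPoset) where

  open FiniteBinomialPoset P

  private
    variable
      f : ℕ
      x y : Fin card

  lt⇒le : T (lt x y) → T (le x y)
  lt⇒le = proj₁ ∘ Equivalence.to T-∧

  lt⇒≢ : T (lt x y) → x ≢ y
  lt⇒≢ {x} {y} x<y x≡y with x ≟ᶠ y
  ... | yes _ = proj₂ (Equivalence.to T-∧ x<y)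
  ... | no x≢y = x≢y x≡y

  covers⇒lt : T (covers x y) → T (lt x y)
  covers⇒lt = proj₁ ∘ Equivalence.to T-∧

  covers⇒le : T (covers x y) → T (le x y)
  covers⇒le = lt⇒le ∘ covers⇒lt

  chainsFuel-refl : ∀ f x → chainsFuel f x x ≡ 1
  chainsFuel-refl zero x with x ≟ᶠ x
  ... | yes _ = refl
  ... | no x≢x = ⊥-elim (x≢x refl)
  chainsFuel-refl (suc f) x with x ≟ᶠ x
  ... | yes _ = refl
  ... | no x≢x = ⊥-elim (x≢x refl)

  chainsFuel-suc : x ≢ y → chainsFuel (suc f) x y ≡
    sum (map (λ z → if covers x z ∧ le z y then chainsFuel f z y else 0) (allFin card))
  chainsFuel-suc {x = x} {y = y} x≢y with x ≟ᶠ y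
  ... | yes x≡y = ⊥-elim (x≢y x≡y)
  ... | no _ = refl

  chainsFuel-support : ∀ f → chainsFuel f x y ≢ 0 → x ≡ y ⊎ (ρ x < ρ y × ρ y ≤ ρ x + f)
  chainsFuel-support {x = x} {y = y} zero chains≢0 with x ≟ᶠ y
  ... | yes x≡y = inj₁ x≡y
  ... | no _ = ⊥-elim (chains≢0 refl)
  chainsFuel-support {x = x} {y = y} (suc f) chains≢0 with x ≟ᶠ y
  ... | yes x≡y = inj₁ x≡y
  ... | no _
    with z , summand≢0 ← sum≢0⇒∃≢0 _ (allFin card) chains≢0
    with covers x z ∧ le z y in x⋖z≤y
  ... | false = ⊥-elim (summand≢0 refl)
  ... | true = inj₂ (<-≤-trans (≤-reflexive (sym ρz)) (proj₁ bounds) , ρy≤ρx+1+f)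
    where
    ρz : ρ z ≡ suc (ρ x)
    ρz = ρ-cover x z (proj₁ (Equivalence.to T-∧ (Equivalence.from T-≡ x⋖z≤y)))
    bounds : ρ z ≤ ρ y × ρ y ≤ ρ z + f
    bounds with chainsFuel-support f summand≢0
    ... | inj₁ refl = ≤-refl , m≤m+n (ρ z) f
    ... | inj₂ (ρz<ρy , ρy≤) = <⇒≤ ρz<ρy , ρy≤
    ρy≤ρx+1+f : ρ y ≤ ρ x + suc f
    ρy≤ρx+1+f = ≤-trans (proj₂ bounds) (≤-reflexive (trans (cong (_+ f) ρz) (sym (+-suc (ρ x) f))))

  chainsFuel-vanishes : x ≢ y → ρ y ≤ ρ x → chainsFuel f x y ≡ 0
  chainsFuel-vanishes {x = x} {y = y} {f = f} x≢y ρy≤ρx with chainsFuel f x y ≟ 0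
  ... | yes chains≡0 = chains≡0
  ... | no chains≢0 with chainsFuel-support f chains≢0
  ...   | inj₁ x≡y = ⊥-elim (x≢y x≡y)
  ...   | inj₂ (ρx<ρy , _) = ⊥-elim (<⇒≱ ρx<ρy ρy≤ρx)

  chainsFuel-succ : ρ y ∸ ρ x ≤ f → chainsFuel f x y ≡ chainsFuel (suc f) x y
  chainsFuel-succ {y = y} {x = x} {f = zero} gap≤0 with x ≟ᶠ y
  ... | yes _ = refl
  ... | no x≢y =
    sym (trans (sym (chainsFuel-suc {f = 0} x≢y))
               (chainsFuel-vanishes {f = 1} x≢y (m∸n≡0⇒m≤n (n≤0⇒n≡0 gap≤0))))
  chainsFuel-succ {y = y} {x = x} {f = suc f} gap≤1+f with x ≟ᶠ y
  ... | yes _ = refl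
  ... | no x≢y =
    sum-map-if-cong (λ z → covers x z ∧ le z y) summand≡ (allFin card)
    where
    summand≡ : ∀ z → T (covers x z ∧ le z y) → chainsFuel f z y ≡ chainsFuel (suc f) z y
    summand≡ z x⋖z≤y = chainsFuel-succ (begin
      ρ y ∸ ρ z        ≡⟨ cong (ρ y ∸_) (ρ-cover x z (proj₁ (Equivalence.to T-∧ x⋖z≤y))) ⟩
      ρ y ∸ suc (ρ x)  ≡⟨ pred[m∸n]≡m∸[1+n] (ρ y) (ρ x) ⟨
      pred (ρ y ∸ ρ x) ≤⟨ pred-mono-≤ gap≤1+f ⟩
      f                ∎)
      where open ≤-Reasoning

  chainsFuel-saturates : ρ y ∸ ρ x ≤ f → chainsFuel f x y ≡ chainsFuel (ρ y ∸ ρ x) x y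
  chainsFuel-saturates {y = y} {x = x} gap≤f with k , gap+k≡f ← m≤n⇒∃[o]m+o≡n gap≤f =
    trans (cong (λ f → chainsFuel f x y) (sym gap+k≡f)) (extra k)
    where
    extra : ∀ k → chainsFuel (ρ y ∸ ρ x + k) x y ≡ chainsFuel (ρ y ∸ ρ x) x y
    extra zero = cong (λ f → chainsFuel f x y) (+-identityʳ (ρ y ∸ ρ x))
    extra (suc k) = begin
      chainsFuel (ρ y ∸ ρ x + suc k) x y  ≡⟨ cong (λ f → chainsFuel f x y) (+-suc (ρ y ∸ ρ x) k) ⟩
      chainsFuel (suc (ρ y ∸ ρ x + k)) x y ≡⟨ chainsFuel-succ (m≤m+n (ρ y ∸ ρ x) k) ⟨
      chainsFuel (ρ y ∸ ρ x + k) x y      ≡⟨ extra k ⟩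
      chainsFuel (ρ y ∸ ρ x) x y          ∎
      where open ≡-Reasoning

  B-zero : B 0 ≡ 1
  B-zero = begin
    B 0                     ≡⟨ cong B (n∸n≡0 (ρ bot)) ⟨
    B (ρ bot ∸ ρ bot)       ≡⟨ B-spec bot bot (le-refl bot) ⟨
    chainsFuel card bot bot ≡⟨ chainsFuel-refl card bot ⟩
    1                       ∎
    where open ≡-Reasoning

  ρ-mono : T (le x y) → ρ x ≤ ρ y
  ρ-mono {x = x} {y = y} x≤y with ρ x ≤? ρ y
  ... | yes ρx≤ρy = ρx≤ρy
  ... | no ρx≰ρy with chainsFuel-support card maxChains≢0
    where
    maxChains≢0 : maxChains x y ≢ 0
    maxChains≢0 rewrite B-spec x y x≤y | m≤n⇒m∸n≡0 (<⇒≤ (≰⇒> ρx≰ρy)) | B-zero = λ ()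
  ...   | inj₁ refl = ≤-refl
  ...   | inj₂ (ρx<ρy , _) = <⇒≤ ρx<ρy

  B-positive : ∀ k → (∀ i → i < k → ∃[ a ] a ≢ 0 × AtomFunctionIs (suc i) a) → B k ≢ 0
  B-positive zero _ B0≡0 = 1+n≢0 (trans (sym B-zero) B0≡0)
  B-positive (suc k) A≢0 Bk+1≡0 with a , a≢0 , Bk+1≡aBk ← A≢0 k ≤-refl
    with m*n≡0⇒m≡0∨n≡0 a (trans (sym Bk+1≡aBk) Bk+1≡0)
  ... | inj₁ a≡0 = a≢0 a≡0
  ... | inj₂ Bk≡0 = B-positive k (λ i i<k → A≢0 i (m≤n⇒m≤1+n i<k)) Bk≡0

-- Positivity of B holds in every finite binomial poset; here it is assumed, and for the theorem it
-- follows from the atom function by B-positive.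
module Atoms (P : FiniteBinomialPoset)
  (B-pos : ∀ k → k ≤ FiniteBinomialPoset.rank P → FiniteBinomialPoset.B P k ≢ 0) where

  open FiniteBinomialPoset P
  open Chains P

  private
    variable
      d : ℕ
      u w x y z : Fin card

  ρ≤rank : ∀ y → ρ y ≤ rank
  ρ≤rank y = ρ-mono (top-max y)

  maxChains≢0 : T (le x y) → maxChains x y ≢ 0
  maxChains≢0 {x = x} {y = y} x≤y rewrite B-spec x y x≤y =
    B-pos (ρ y ∸ ρ x) (≤-trans (m∸n≤m (ρ y) (ρ x)) (ρ≤rank y))

  ρ-strict : T (le x y) → x ≢ y → ρ x < ρ y
  ρ-strict x≤y x≢y with chainsFuel-support card (maxChains≢0 x≤y)
  ... | inj₁ x≡y = ⊥-elim (x≢y x≡y)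
  ... | inj₂ (ρx<ρy , _) = ρx<ρy

  rank≤card : rank ≤ card
  rank≤card with chainsFuel-support card (maxChains≢0 (top-max bot))
  ... | inj₁ refl = subst (_≤ card) (sym ρ-bot) z≤n
  ... | inj₂ (_ , ρtop≤ρbot+card) = subst (λ r → rank ≤ r + card) ρ-bot ρtop≤ρbot+card

  chainsFuel≡B : T (le x y) → ρ y ≡ d + ρ x → chainsFuel d x y ≡ B d
  chainsFuel≡B {x = x} {y = y} {d = d} x≤y ρy≡d+ρx =
    subst (λ e → chainsFuel e x y ≡ B e) gap≡d
      (trans (sym (chainsFuel-saturates gap≤card)) (B-spec x y x≤y))
    where
    gap≡d : ρ y ∸ ρ x ≡ d
    gap≡d = trans (cong (_∸ ρ x) ρy≡d+ρx) (m+n∸n≡m d (ρ x))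
    gap≤card : ρ y ∸ ρ x ≤ card
    gap≤card = ≤-trans (m∸n≤m (ρ y) (ρ x)) (≤-trans (ρ≤rank y) rank≤card)

  opaque
    atoms : Fin card → Fin card → List (Fin card)
    atoms x y = filter (λ z → T? (covers x z ∧ le z y)) (allFin card)

    atoms-unique : Unique (atoms x y)
    atoms-unique {x = x} {y = y} = Unique.filter⁺ (λ z → T? (covers x z ∧ le z y)) (Unique.allFin⁺ card)

    ∈-atoms⁺ : T (covers x z) → T (le z y) → z ∈ atoms x y
    ∈-atoms⁺ {x = x} {z = z} {y = y} x⋖z z≤y =
      ∈-filter⁺ (λ z → T? (covers x z ∧ le z y)) (∈-allFin z) (Equivalence.from T-∧ (x⋖z , z≤y))

    ∈-atoms⁻ : z ∈ atoms x y → T (covers x z) × T (le z y)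
    ∈-atoms⁻ {x = x} {y = y} z∈ =
      Equivalence.to T-∧ (proj₂ (∈-filter⁻ (λ z → T? (covers x z ∧ le z y)) {xs = allFin card} z∈))

    sum-atoms : ∀ n →
      sum (map (λ z → if covers x z ∧ le z y then n else 0) (allFin card)) ≡ length (atoms x y) * n
    sum-atoms {x = x} {y = y} n = sum-map-if-const (λ z → covers x z ∧ le z y) n (allFin card)

  B-atoms : T (le x y) → ρ y ≡ suc d + ρ x → B (suc d) ≡ length (atoms x y) * B d
  B-atoms {x = x} {y = y} {d = d} x≤y ρy≡ = begin
    B (suc d)
      ≡⟨ chainsFuel≡B x≤y ρy≡ ⟨
    chainsFuel (suc d) x y
      ≡⟨ chainsFuel-suc {f = d} x≢y ⟩
    sum (map (λ z → if covers x z ∧ le z y then chainsFuel d z y else 0) (allFin card))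
      ≡⟨ sum-map-if-cong (λ z → covers x z ∧ le z y) chains≡B (allFin card) ⟩
    sum (map (λ z → if covers x z ∧ le z y then B d else 0) (allFin card))
      ≡⟨ sum-atoms (B d) ⟩
    length (atoms x y) * B d
      ∎
    where
    open ≡-Reasoning
    x≢y : x ≢ y
    x≢y refl = m+1+n≢n d (trans (+-suc d (ρ x)) (sym ρy≡))
    chains≡B : ∀ z → T (covers x z ∧ le z y) → chainsFuel d z y ≡ B d
    chains≡B z x⋖z≤y with x⋖z , z≤y ← Equivalence.to T-∧ x⋖z≤y =
      chainsFuel≡B z≤y (trans ρy≡ (trans (sym (+-suc d (ρ x))) (cong (d +_) (sym (ρ-cover x z x⋖z)))))

  covers-by-rank : T (le x y) → ρ y ≡ suc (ρ x) → T (covers x y)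
  covers-by-rank {x = x} {y = y} x≤y ρy≡ =
    Equivalence.from T-∧ (Equivalence.from T-∧ (x≤y , x≢y) , Equivalence.from T-not-≡ nothing-between)
    where
    x≢y : T (not (isYes (x ≟ᶠ y)))
    x≢y with x ≟ᶠ y
    ... | yes refl = ⊥-elim (1+n≢n (sym ρy≡))
    ... | no _ = tt
    ρ-between : ∀ {z} → T (lt x z ∧ lt z y) → ρ x < ρ z × ρ z < ρ y
    ρ-between x<z<y with x<z , z<y ← Equivalence.to T-∧ x<z<y =
      ρ-strict (lt⇒le x<z) (lt⇒≢ x<z) , ρ-strict (lt⇒le z<y) (lt⇒≢ z<y)
    nothing-between : any (λ z → lt x z ∧ lt z y) (allFin card) ≡ false
    nothing-between with any (λ z → lt x z ∧ lt z y) (allFin card) in found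
    ... | false = refl
    ... | true with z , _ , x<z<y ← find (any⁻ (λ z → lt x z ∧ lt z y) (allFin card) (Equivalence.from T-≡ found))
      = ⊥-elim (<⇒≱ (proj₂ (ρ-between x<z<y)) (subst (_≤ ρ z) (sym ρy≡) (proj₁ (ρ-between x<z<y))))

  atom-ρ : x ∈ atoms u y → ρ x ≡ suc (ρ u)
  atom-ρ {x = x} {u = u} x∈ = ρ-cover u x (proj₁ (∈-atoms⁻ x∈))

  atom-le-upper : x ∈ atoms u y → T (le x y)
  atom-le-upper = proj₂ ∘ ∈-atoms⁻

  atom⇒covers : x ∈ atoms u y → T (covers u x)
  atom⇒covers = proj₁ ∘ ∈-atoms⁻

  base-le-atom : x ∈ atoms u y → T (le u x)
  base-le-atom = covers⇒le ∘ atom⇒covers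

  base-le-upper : x ∈ atoms u y → T (le u y)
  base-le-upper {x = x} {u = u} {y = y} x∈ = le-trans u x y (base-le-atom x∈) (atom-le-upper x∈)

  atom-restrict : x ∈ atoms u y → T (le x z) → x ∈ atoms u z
  atom-restrict x∈ x≤z = ∈-atoms⁺ (atom⇒covers x∈) x≤z

  atom-under-cover : x ∈ atoms u z → y ∈ atoms x w → x ∈ atoms u y
  atom-under-cover x∈ y∈ = atom-restrict x∈ (base-le-atom y∈)

  ρ-above-atom : ∀ m → ρ z ≡ suc m + ρ u → x ∈ atoms u y → ρ z ≡ m + ρ x
  ρ-above-atom {z = z} {u = u} m ρz x∈ = trans ρz (trans (sym (+-suc m (ρ u))) (cong (m +_) (sym (atom-ρ x∈))))

  AtomCount : ℕ → ℕ → Set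
  AtomCount m a = ∀ {x y} → T (le x y) → ρ y ≡ m + ρ x → length (atoms x y) ≡ a

  atomCount : ∀ {d a} → d ≤ rank → AtomFunctionIs (suc d) a → AtomCount (suc d) a
  atomCount {d} {a} d≤rank Bsd≡aBd x≤y ρy≡ =
    *-cancelʳ-≡ (length (atoms _ _)) a (B d) {{≢-nonZero (B-pos d d≤rank)}}
      (trans (sym (B-atoms x≤y ρy≡)) Bsd≡aBd)

  module RankManyAtoms (j : ℕ) (3≤j : 3 ≤ j) (atoms-rank : ∀ m → 1 ≤ m → m ≤ j → AtomCount m m) where

    open DistinctLists (_≟ᶠ_ {card})
    open import Data.List.Membership.DecPropositional (_≟ᶠ_ {card}) using (_∈?_)

    private
      variable
        a a* b c r t v w′ w″ x′ y′ : Fin card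

    2≤j : 2 ≤ j
    2≤j = ≤-trans (n≤1+n 2) 3≤j

    atom-ρ₂ : x ∈ atoms u w → y ∈ atoms x w′ → ρ y ≡ 2 + ρ u
    atom-ρ₂ x∈ y∈ = trans (atom-ρ y∈) (cong suc (atom-ρ x∈))

    atom-ρ₃ : a ∈ atoms u w → x ∈ atoms a w′ → y ∈ atoms x w″ → ρ y ≡ 3 + ρ u
    atom-ρ₃ a∈ x∈ y∈ = trans (atom-ρ y∈) (cong suc (atom-ρ₂ a∈ x∈))

    atom-under-cover₂ : a ∈ atoms u w → x ∈ atoms a w′ → y ∈ atoms x w″ → a ∈ atoms u y
    atom-under-cover₂ {a = a} {x = x} {y = y} a∈ x∈ y∈ =
      atom-restrict a∈ (le-trans a x y (base-le-atom x∈) (base-le-atom y∈))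

    rank₂-atoms : ρ y ≡ 2 + ρ u → T (le u y) → length (atoms u y) ≡ 2
    rank₂-atoms ρy u≤y = atoms-rank 2 (s≤s z≤n) 2≤j u≤y ρy

    rank₃-atoms : ρ z ≡ 3 + ρ u → T (le u z) → length (atoms u z) ≡ 3
    rank₃-atoms ρz u≤z = atoms-rank 3 (s≤s z≤n) 3≤j u≤z ρz

    rank₂-pair : ρ y ≡ 2 + ρ u → a ∈ atoms u y → b ∈ atoms u y → a ≢ b →
      r ∈ atoms u y → r ≡ a ⊎ r ≡ b
    rank₂-pair ρy a∈ = length≡2⇒pair (rank₂-atoms ρy (base-le-upper a∈)) a∈

    rank₂-covers : ρ y ≡ 2 + ρ u → x ∈ atoms u y → T (covers x y)
    rank₂-covers ρy x∈ = covers-by-rank (atom-le-upper x∈) (trans ρy (cong suc (sym (atom-ρ x∈))))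

    partner : Fin card → Fin card → Fin card → Fin card
    partner u x y = other (atoms u y) x

    partner-spec : ρ y ≡ 2 + ρ u → x ∈ atoms u y → partner u x y ∈ atoms u y × partner u x y ≢ x
    partner-spec ρy x∈
      with r , r∈ , r∉[x] ← length<⇒∃∉ {xs = _ ∷ []} atoms-unique
                              (≤-reflexive (sym (rank₂-atoms ρy (base-le-upper x∈))))
      = other-spec r∈ (r∉[x] ∘ here)

    partner-unique : ρ y ≡ 2 + ρ u → x ∈ atoms u y → c ∈ atoms u y → c ≢ x → partner u x y ≡ c
    partner-unique ρy x∈ c∈ c≢x with partner-spec ρy x∈
    ... | p∈ , p≢x = [ ⊥-elim ∘ p≢x , id ]′ (rank₂-pair ρy x∈ c∈ (c≢x ∘ sym) p∈)

    -- A third atom r of [u, z] lies under some t; the other atom of [u, t] is x or v, which forces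
    -- t ∈ {y, y′} and puts the three atoms x, v, r into the 2-interval [u, t].
    no-double-diamond : ρ z ≡ 3 + ρ u → x ∈ atoms u z → v ∈ atoms u z → x ≢ v →
      y ∈ atoms x z → y ∈ atoms v z → y′ ∈ atoms x z → y′ ∈ atoms v z → y ≢ y′ → ⊥
    no-double-diamond {z = z} {u = u} {x = x} {v = v} {y = y} {y′ = y′}
      ρz x∈ v∈ x≢v y∈x y∈v y′∈x y′∈v y≢y′
      with r , r∈ , r∉xv ← length<⇒∃∉ {xs = x ∷ v ∷ []} atoms-unique
                             (≤-reflexive (sym (rank₃-atoms ρz (base-le-upper x∈))))
      with t , t∈ ← nonempty⇒∃∈ (≤-trans (s≤s z≤n)
                      (≤-reflexive (sym (rank₂-atoms (ρ-above-atom 2 ρz r∈) (atom-le-upper r∈)))))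
      = r∉xv ([ here , there ∘ here ]′ r∈xv)
      where
      ρt : ρ t ≡ 2 + ρ u
      ρt = atom-ρ₂ r∈ t∈
      r∈t : r ∈ atoms u t
      r∈t = atom-under-cover r∈ t∈
      s = partner u r t
      s∈t : s ∈ atoms u t
      s∈t = proj₁ (partner-spec ρt r∈t)
      s∈z : s ∈ atoms u z
      s∈z = atom-restrict s∈t (le-trans s t z (atom-le-upper s∈t) (atom-le-upper t∈))
      s∈xv : s ≡ x ⊎ s ≡ v
      s∈xv with length≡3⇒triple (rank₃-atoms ρz (base-le-upper x∈)) x∈ v∈ r∈ x≢v
                  (r∉xv ∘ here ∘ sym) (r∉xv ∘ there ∘ here ∘ sym) s∈z
      ... | inj₁ s≡x = inj₁ s≡x
      ... | inj₂ (inj₁ s≡v) = inj₂ s≡v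
      ... | inj₂ (inj₂ s≡r) = ⊥-elim (proj₂ (partner-spec ρt r∈t) s≡r)
      y,y′∈s : y ∈ atoms s z × y′ ∈ atoms s z
      y,y′∈s = [ (λ { refl → y∈x , y′∈x }) , (λ { refl → y∈v , y′∈v }) ]′ s∈xv
      t∈yy′ : t ≡ y ⊎ t ≡ y′
      t∈yy′ = rank₂-pair (ρ-above-atom 2 ρz s∈z) (proj₁ y,y′∈s) (proj₂ y,y′∈s) y≢y′
                (∈-atoms⁺ (rank₂-covers ρt s∈t) (atom-le-upper t∈))
      below-t : ∀ {c} → c ∈ atoms u z → y ∈ atoms c z → y′ ∈ atoms c z → c ∈ atoms u t
      below-t c∈ y∈c y′∈c = atom-under-cover c∈ ([ (λ { refl → y∈c }) , (λ { refl → y′∈c }) ]′ t∈yy′)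
      r∈xv : r ≡ x ⊎ r ≡ v
      r∈xv = rank₂-pair ρt (below-t x∈ y∈x y′∈x) (below-t v∈ y∈v y′∈v) x≢v r∈t

    partner-of-cover : x ∈ atoms u z → y ∈ atoms x z →
      partner u x y ∈ atoms u z × partner u x y ≢ x × y ∈ atoms (partner u x y) z
    partner-of-cover {x = x} {u = u} {z = z} {y = y} x∈ y∈ =
      atom-restrict p∈y (le-trans (partner u x y) y z (atom-le-upper p∈y) (atom-le-upper y∈)) ,
      proj₂ (partner-spec ρy x∈y) ,
      ∈-atoms⁺ (rank₂-covers ρy p∈y) (atom-le-upper y∈)
      where
      ρy : ρ y ≡ 2 + ρ u
      ρy = atom-ρ₂ x∈ y∈
      x∈y : x ∈ atoms u y
      x∈y = atom-under-cover x∈ y∈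
      p∈y : partner u x y ∈ atoms u y
      p∈y = proj₁ (partner-spec ρy x∈y)

    partner-injective : ρ z ≡ 3 + ρ u → x ∈ atoms u z → y ∈ atoms x z → y′ ∈ atoms x z →
      partner u x y ≡ partner u x y′ → y ≡ y′
    partner-injective {z = z} {y = y} {y′ = y′} ρz x∈ y∈ y′∈ same with y ≟ᶠ y′
    ... | yes y≡y′ = y≡y′
    ... | no y≢y′ with p∈ , p≢x , y∈p ← partner-of-cover x∈ y∈ with _ , _ , y′∈p′ ← partner-of-cover x∈ y′∈ =
      ⊥-elim (no-double-diamond ρz x∈ p∈ (p≢x ∘ sym) y∈ y∈p y′∈
                (subst (λ p → y′ ∈ atoms p z) (sym same) y′∈p′) y≢y′)

    JointCover : Fin card → Fin card → Fin card → Set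
    JointCover x x′ w = ∃[ y ] y ∈ atoms x w × y ∈ atoms x′ w

    JointCoversAtRank : ℕ → Set
    JointCoversAtRank m = ∀ {u w x x′} → ρ w ≡ m + ρ u →
      x ∈ atoms u w → x′ ∈ atoms u w → x ≢ x′ → JointCover x x′ w

    JointCover-mono : T (le y z) → JointCover b c y → JointCover b c z
    JointCover-mono y≤z (t , t∈b , t∈c) =
      t , atom-restrict t∈b (le-trans _ _ _ (atom-le-upper t∈b) y≤z) ,
          atom-restrict t∈c (le-trans _ _ _ (atom-le-upper t∈c) y≤z)

    joint-covers₂ : JointCoversAtRank 2
    joint-covers₂ {w = w} ρw x∈ x′∈ _ =
      w , ∈-atoms⁺ (rank₂-covers ρw x∈) (le-refl w) , ∈-atoms⁺ (rank₂-covers ρw x′∈) (le-refl w)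

    -- Without a common cover, the partners of the m covers of x would be atoms of [u, w] other than
    -- x and x′, pairwise distinct by partner-injective: m + 2 atoms in an (m + 1)-interval.
    joint-covers-step : ∀ m → 2 ≤ m → suc m ≤ j → JointCoversAtRank m → JointCoversAtRank (suc m)
    joint-covers-step m 2≤m m<j IH {u} {w} {x} {x′} ρw x∈ x′∈ x≢x′
      with any? (λ y → y ∈? atoms x′ w) (atoms x w)
    ... | yes found with y , y∈x , y∈x′ ← find found = y , y∈x , y∈x′
    ... | no none = ⊥-elim ([ collision , injective ]′ (collision-or-injectiveOn _≟ᶠ_ (partner u x) (atoms x w)))
      where
      ρw-x : ρ w ≡ m + ρ x
      ρw-x = ρ-above-atom m ρw x∈
      collision : ¬ (∃[ y ] ∃[ y′ ] y ∈ atoms x w × y′ ∈ atoms x w × y ≢ y′ ×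
                       partner u x y ≡ partner u x y′)
      collision (y , y′ , y∈ , y′∈ , y≢y′ , same) with z , z∈y , z∈y′ ← IH ρw-x y∈ y′∈ y≢y′ =
        y≢y′ (partner-injective (atom-ρ₃ x∈ y∈ z∈y) (atom-under-cover₂ x∈ y∈ z∈y)
          (atom-under-cover y∈ z∈y) (atom-under-cover y′∈ z∈y′) same)
      partners : List (Fin card)
      partners = x ∷ x′ ∷ map (partner u x) (atoms x w)
      ∉-partners : ∀ {c} → (∀ {y} → y ∈ atoms x w → partner u x y ≢ c) →
        c ∉ map (partner u x) (atoms x w)
      ∉-partners p≢c c∈ with y , y∈ , c≡p ← ∈-map⁻ (partner u x) c∈ = p≢c y∈ (sym c≡p)
      partners-unique : InjectiveOn (partner u x) (atoms x w) → Unique partners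
      partners-unique inj =
        ¬Any⇒All¬ _ (λ { (here x≡x′) → x≢x′ x≡x′
                       ; (there x∈ps) → ∉-partners (proj₁ ∘ proj₂ ∘ partner-of-cover x∈) x∈ps }) ∷
        ¬Any⇒All¬ _ (∉-partners (λ y∈ p≡x′ → none (lose y∈
          (subst (λ p → _ ∈ atoms p w) p≡x′ (proj₂ (proj₂ (partner-of-cover x∈ y∈))))))) ∷
        map⁺ inj atoms-unique
      partners⊆ : partners ⊆ atoms u w
      partners⊆ (here refl) = x∈
      partners⊆ (there (here refl)) = x′∈
      partners⊆ (there (there c∈)) with y , y∈ , refl ← ∈-map⁻ (partner u x) c∈ =
        proj₁ (partner-of-cover x∈ y∈)
      injective : ¬ InjectiveOn (partner u x) (atoms x w)
      injective inj = 1+n≰n (begin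
        suc (suc m)
          ≡⟨ cong (suc ∘ suc) (atoms-rank m (≤-trans (s≤s z≤n) 2≤m) (<⇒≤ m<j) (atom-le-upper x∈) ρw-x) ⟨
        suc (suc (length (atoms x w)))
          ≡⟨ cong (suc ∘ suc) (length-map (partner u x) (atoms x w)) ⟨
        length partners
          ≤⟨ ⊆⇒length≤ (partners-unique inj) partners⊆ ⟩
        length (atoms u w)
          ≡⟨ atoms-rank (suc m) (s≤s z≤n) m<j (base-le-upper x∈) ρw ⟩
        suc m
          ∎)
        where open ≤-Reasoning

    joint-covers : ∀ m → 2 ≤ m → m ≤ j → JointCoversAtRank m
    joint-covers (suc zero) (s≤s ()) _
    joint-covers (suc (suc zero)) _ _ = joint-covers₂
    joint-covers (suc (suc (suc k))) _ m≤j =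
      joint-covers-step (suc (suc k)) (s≤s (s≤s z≤n)) m≤j
        (joint-covers (suc (suc k)) (s≤s (s≤s z≤n)) (≤-trans (n≤1+n _) m≤j))

    third-atom-adjacent : ρ y ≡ 3 + ρ u → a ∈ atoms u y → b ∈ atoms u y → c ∈ atoms u y →
      a ≢ b → a ≢ c → b ≢ c → x ∈ atoms a y → x ∈ atoms b y → t ∈ atoms b y → x ≢ t →
      JointCover b c y
    third-atom-adjacent ρy a∈ b∈ c∈ a≢b a≢c b≢c x∈a x∈b t∈b x≢t
      with s∈ , s≢b , t∈s ← partner-of-cover b∈ t∈b
      with length≡3⇒triple (rank₃-atoms ρy (base-le-upper a∈)) a∈ b∈ c∈ a≢b a≢c b≢c s∈
    ... | inj₁ refl = ⊥-elim (no-double-diamond ρy a∈ b∈ a≢b x∈a x∈b t∈s t∈b x≢t)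
    ... | inj₂ (inj₁ s≡b) = ⊥-elim (s≢b s≡b)
    ... | inj₂ (inj₂ refl) = _ , t∈b , t∈s

    partners-adjacent : ρ y ≡ 3 + ρ u → a ∈ atoms u y → x ∈ atoms a y → x′ ∈ atoms a y →
      partner u a x ≢ partner u a x′ → JointCover (partner u a x) (partner u a x′) y
    partners-adjacent ρy a∈ x∈ x′∈ b≢c
      with b∈ , b≢a , x∈b ← partner-of-cover a∈ x∈
      with c∈ , c≢a , _ ← partner-of-cover a∈ x′∈
      with t∈b , t≢x ← partner-spec (ρ-above-atom 2 ρy b∈) x∈b
      = third-atom-adjacent ρy a∈ b∈ c∈ (b≢a ∘ sym) (c≢a ∘ sym) b≢c x∈ x∈b t∈b (t≢x ∘ sym)

    module AtomGraph (rank≡1+j : rank ≡ suc j) where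

      neighbours : Fin card → List (Fin card)
      neighbours a = map (partner bot a) (atoms a top)

      closedNeighbourhood : Fin card → List (Fin card)
      closedNeighbourhood a = a ∷ neighbours a

      top-rank : ρ top ≡ suc j + ρ bot
      top-rank = trans rank≡1+j (sym (trans (cong (suc j +_) ρ-bot) (+-identityʳ (suc j))))

      ρ-top : a ∈ atoms bot top → ρ top ≡ j + ρ a
      ρ-top = ρ-above-atom j top-rank

      joint-covers-top : a ∈ atoms bot top → x ∈ atoms a top → x′ ∈ atoms a top → x ≢ x′ →
        JointCover x x′ top
      joint-covers-top a∈ = joint-covers j 2≤j ≤-refl (ρ-top a∈)

      partner-top-injective : a ∈ atoms bot top → x ∈ atoms a top → x′ ∈ atoms a top →
        partner bot a x ≡ partner bot a x′ → x ≡ x′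
      partner-top-injective {a = a} {x = x} {x′ = x′} a∈ x∈ x′∈ same with x ≟ᶠ x′
      ... | yes x≡x′ = x≡x′
      ... | no x≢x′ with y , y∈x , y∈x′ ← joint-covers-top a∈ x∈ x′∈ x≢x′ =
        partner-injective (atom-ρ₃ a∈ x∈ y∈x) (atom-under-cover₂ a∈ x∈ y∈x)
          (atom-under-cover x∈ y∈x) (atom-under-cover x′∈ y∈x′) same

      ∈-neighbours⁻ : a ∈ atoms bot top → c ∈ neighbours a → c ∈ atoms bot top × c ≢ a
      ∈-neighbours⁻ a∈ c∈ with x , x∈ , refl ← ∈-map⁻ _ c∈ =
        proj₁ (partner-of-cover a∈ x∈) , proj₁ (proj₂ (partner-of-cover a∈ x∈))

      neighbours-unique : a ∈ atoms bot top → Unique (neighbours a)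
      neighbours-unique a∈ = map⁺ (partner-top-injective a∈) atoms-unique

      closedNeighbourhood-unique : a ∈ atoms bot top → Unique (closedNeighbourhood a)
      closedNeighbourhood-unique a∈ =
        ¬Any⇒All¬ _ (λ a∈N → proj₂ (∈-neighbours⁻ a∈ a∈N) refl) ∷ neighbours-unique a∈

      length-closedNeighbourhood : a ∈ atoms bot top → length (closedNeighbourhood a) ≡ suc j
      length-closedNeighbourhood {a = a} a∈ = cong suc (trans (length-map (partner bot a) (atoms a top))
        (atoms-rank j (≤-trans (s≤s z≤n) 2≤j) ≤-refl (top-max a) (ρ-top a∈)))

      common-cover⇒neighbour : a ∈ atoms bot top → c ∈ atoms bot top → c ≢ a →
        x ∈ atoms a top → x ∈ atoms c top → c ∈ neighbours a
      common-cover⇒neighbour {a = a} {c = c} {x = x} a∈ c∈ c≢a x∈a x∈c =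
        subst (_∈ neighbours a)
          (partner-unique (atom-ρ₂ a∈ x∈a) (atom-under-cover a∈ x∈a) (atom-under-cover c∈ x∈c) c≢a)
          (∈-map⁺ (partner bot a) x∈a)

      neighbours-sym : a ∈ atoms bot top → x ∈ atoms a top → a ∈ neighbours (partner bot a x)
      neighbours-sym a∈ x∈ with c∈ , c≢a , x∈c ← partner-of-cover a∈ x∈ =
        common-cover⇒neighbour c∈ a∈ (c≢a ∘ sym) x∈c x∈

      joint-cover⇒neighbour : a ∈ atoms bot top → c ∈ atoms bot top → c ≢ a →
        JointCover a c top → c ∈ neighbours a
      joint-cover⇒neighbour a∈ c∈ c≢a (x , x∈a , x∈c) = common-cover⇒neighbour a∈ c∈ c≢a x∈a x∈c

      neighbours-adjacent : a ∈ atoms bot top → x ∈ atoms a top → x′ ∈ atoms a top → x ≢ x′ →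
        JointCover (partner bot a x) (partner bot a x′) top
      neighbours-adjacent {a = a} {x = x} {x′ = x′} a∈ x∈ x′∈ x≢x′ =
        via (joint-covers-top a∈ x∈ x′∈ x≢x′)
        where
        via : JointCover x x′ top → JointCover (partner bot a x) (partner bot a x′) top
        via (y , y∈x , y∈x′) = JointCover-mono (top-max y)
          (partners-adjacent (atom-ρ₃ a∈ x∈ y∈x) (atom-under-cover₂ a∈ x∈ y∈x)
            (atom-under-cover x∈ y∈x) (atom-under-cover x′∈ y∈x′)
            (x≢x′ ∘ partner-top-injective a∈ x∈ x′∈))

      neighbour-∈-closedNeighbourhood : a ∈ atoms bot top → x ∈ atoms a top → x′ ∈ atoms a top →
        partner bot a x′ ∈ closedNeighbourhood (partner bot a x)
      neighbour-∈-closedNeighbourhood {a = a} {x = x} {x′ = x′} a∈ x∈ x′∈ with x ≟ᶠ x′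
      ... | yes refl = here refl
      ... | no x≢x′ = there (joint-cover⇒neighbour
                        (proj₁ (partner-of-cover a∈ x∈)) (proj₁ (partner-of-cover a∈ x′∈))
                        (x≢x′ ∘ partner-top-injective a∈ x∈ x′∈ ∘ sym) (neighbours-adjacent a∈ x∈ x′∈ x≢x′))

      closedNeighbourhood-⊆ : a ∈ atoms bot top → c ∈ neighbours a →
        closedNeighbourhood a ⊆ closedNeighbourhood c
      closedNeighbourhood-⊆ {a = a} a∈ c∈N with x , x∈ , refl ← ∈-map⁻ (partner bot a) c∈N = ⊆
        where
        ⊆ : closedNeighbourhood a ⊆ closedNeighbourhood (partner bot a x)
        ⊆ (here refl) = there (neighbours-sym a∈ x∈)
        ⊆ (there d∈N) with x′ , x′∈ , refl ← ∈-map⁻ (partner bot a) d∈N =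
          neighbour-∈-closedNeighbourhood a∈ x∈ x′∈

      closedNeighbourhood-⊇ : a ∈ atoms bot top → c ∈ neighbours a →
        closedNeighbourhood c ⊆ closedNeighbourhood a
      closedNeighbourhood-⊇ a∈ c∈N =
        length≤⇒⊇ (closedNeighbourhood-unique a∈) (closedNeighbourhood-⊆ a∈ c∈N)
          (≤-reflexive (trans (length-closedNeighbourhood (proj₁ (∈-neighbours⁻ a∈ c∈N)))
                              (sym (length-closedNeighbourhood a∈))))

      atom-above : a ∈ atoms bot top → ∃[ x ] x ∈ atoms a top
      atom-above {a = a} a∈ = nonempty⇒∃∈ (subst (0 <_)
        (sym (atoms-rank j (≤-trans (s≤s z≤n) 2≤j) ≤-refl (top-max a) (ρ-top a∈))) (≤-trans (s≤s z≤n) 2≤j))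

      module _ (count : length (atoms bot top) ≡ j + 2) where

        non-neighbour : a ∈ atoms bot top → ∃[ a* ] a* ∈ atoms bot top × a* ∉ closedNeighbourhood a
        non-neighbour a∈ = length<⇒∃∉ atoms-unique
          (≤-reflexive (trans (cong suc (length-closedNeighbourhood a∈)) (trans (+-comm 2 j) (sym count))))

        atoms-⊆ : a ∈ atoms bot top → a* ∈ atoms bot top → a* ∉ closedNeighbourhood a →
          atoms bot top ⊆ a* ∷ closedNeighbourhood a
        atoms-⊆ {a = a} {a* = a*} a∈ a*∈ a*∉ =
          length≤⇒⊇ (¬Any⇒All¬ _ a*∉ ∷ closedNeighbourhood-unique a∈) ⊆atoms
            (≤-reflexive (trans count (trans (+-comm j 2) (cong suc (sym (length-closedNeighbourhood a∈))))))
          where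
          ⊆atoms : a* ∷ closedNeighbourhood a ⊆ atoms bot top
          ⊆atoms (here refl) = a*∈
          ⊆atoms (there (here refl)) = a∈
          ⊆atoms (there (there d∈N)) = proj₁ (∈-neighbours⁻ a∈ d∈N)

        partner-of-non-neighbour : a ∈ atoms bot top → a* ∈ atoms bot top → a* ∉ closedNeighbourhood a →
          x ∈ atoms a* top → partner bot a* x ∈ neighbours a
        partner-of-non-neighbour {a = a} {a* = a*} {x = x} a∈ a*∈ a*∉ x∈ =
          from (atoms-⊆ a∈ a*∈ a*∉ (proj₁ c-facts))
          where
          c-facts : partner bot a* x ∈ atoms bot top × partner bot a* x ≢ a* × x ∈ atoms (partner bot a* x) top
          c-facts = partner-of-cover a*∈ x∈
          from : partner bot a* x ∈ a* ∷ closedNeighbourhood a → partner bot a* x ∈ neighbours a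
          from (here c≡a*) = ⊥-elim (proj₁ (proj₂ c-facts) c≡a*)
          from (there (here c≡a)) = ⊥-elim (a*∉ (there (common-cover⇒neighbour a∈ a*∈ (a*∉ ∘ here)
                                      (subst (λ c → x ∈ atoms c top) c≡a (proj₂ (proj₂ c-facts))) x∈)))
          from (there (there c∈N)) = c∈N

      atom-count≢j+2 : length (atoms bot top) ≢ j + 2
      atom-count≢j+2 count
        with a , a∈ ← nonempty⇒∃∈ (subst (0 <_) (sym count) (≤-trans (s≤s z≤n) (m≤n+m 2 j)))
        with a* , a*∈ , a*∉ ← non-neighbour count a∈
        with x , x∈ ← atom-above a*∈
        = a*∉ (closedNeighbourhood-⊇ a∈ (partner-of-non-neighbour count a∈ a*∈ a*∉ x∈)
                 (there (neighbours-sym a*∈ x∈)))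

open FiniteBinomialPoset using (rank; AtomFunctionIs)

proposition2p19 : (j : ℕ) → 3 ≤ j →
    ¬ (Σ FiniteBinomialPoset λ P →
         (rank P ≡ suc j)
         × ((n : ℕ) → 1 ≤ n → n ≤ j → AtomFunctionIs P n n)
         × AtomFunctionIs P (suc j) (j + 2))
proposition2p19 j 3≤j (P , rank≡1+j , A≡id , A[1+j]≡j+2) =
  atom-count≢j+2 (atomCount j≤rank A[1+j]≡j+2 (top-max bot) top-rank)
  where
  open FiniteBinomialPoset P hiding (rank; AtomFunctionIs)
  open Chains P
  j≤rank : j ≤ rank P
  j≤rank = subst (j ≤_) (sym rank≡1+j) (n≤1+n j)
  A-nonzero : ∀ i → i < suc j → ∃[ a ] a ≢ 0 × AtomFunctionIs P (suc i) a
  A-nonzero i i<1+j with m≤n⇒m<n∨m≡n (≤-pred i<1+j)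
  ... | inj₁ i<j = suc i , (λ ()) , A≡id (suc i) (s≤s z≤n) i<j
  ... | inj₂ refl = i + 2 , m+1+n≢0 i , A[1+j]≡j+2
  B-pos : ∀ k → k ≤ rank P → B k ≢ 0
  B-pos k k≤rank = B-positive k (λ i i<k → A-nonzero i (≤-trans i<k (subst (k ≤_) rank≡1+j k≤rank)))
  open Atoms P B-pos
  atoms-rank : ∀ m → 1 ≤ m → m ≤ j → AtomCount m m
  atoms-rank (suc d) _ 1+d≤j =
    atomCount (≤-trans (n≤1+n d) (≤-trans 1+d≤j j≤rank)) (A≡id (suc d) (s≤s z≤n) 1+d≤j)
  open RankManyAtoms j 3≤j atoms-rank
  open AtomGraph rank≡1+j
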